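{- For all integers $N\ge 1$ and $n\ge 0$, $$\sum_{i=0}^n\binom{n}{i}\widehat E_{N,i}\widehat E_{N,n-i}=\sum_{k=0}^n\binom{n}{k}\frac{2N-k+1}{2N+1}\widehat E_{N,k}\,E_{N,n-k}.$$
   Context: For an integer $N\ge 0$, the hypergeometric Euler numbers $E_{N,n}$ are defined by $\dfrac{1}{\sum_{m\ge 0}\frac{(2N)!}{(2N+2m)!}t^{2m}}=\sum_{n=0}^\infty E_{N,n}\frac{t^n}{n!}$ (the denominator equals ${}_1F_2(1;N+1,\tfrac{2N+1}{2};\tfrac{t^2}{4})$), and the complementary hypergeometric Euler numbers $\widehat E_{N,n}$ are defined by $$\frac{t^{2N+1}/(2N+1)!}{\sinh t-\sum_{m=0}^{N-1}t^{2m+1}/(2m+1)!}=\sum_{n=0}^\infty\widehat E_{N,n}\frac{t^n}{n!},$$ equivalently $1/\sum_{m\ge0}\frac{(2N+1)!}{(2N+2m+1)!}t^{2m}=\sum_n\widehat E_{N,n}t^n/n!$. -}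

module Defs where

open import Data.Nat as ℕ using (ℕ; zero; suc; _!; _∸_)
open import Data.Nat.Properties using (_!≢0)
open import Data.Nat.Combinatorics using (_C_)
open import Data.Integer using (+_)
open import Data.Rational using (ℚ; 0ℚ; 1ℚ; _+_; _*_; -_; _/_)
open import Data.List using (List; []; _∷_; _∷ʳ_)

ℕ→ℚ : ℕ → ℚ
ℕ→ℚ n = (+ n) / 1

sumTo : ℕ → (ℕ → ℚ) → ℚ
sumTo zero f = f 0
sumTo (suc n) f = sumTo n f + f (suc n)

sumBelow : ℕ → (ℕ → ℚ) → ℚ
sumBelow zero = λ f → 0ℚ
sumBelow (suc n) = λ f → sumBelow n f + f n

at : List ℚ → ℕ → ℚ
at []       _       = 0ℚ
at (x ∷ xs) zero    = x
at (x ∷ xs) (suc k) = at xs k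

-- Exponential-generating coefficients of the reciprocal of a power series
-- A(t) = Σ a n t^n/n!  with a 0 = 1:  1/A(t) = Σ (inv a n) t^n/n!,
-- determined by  Σ_{k=0}^{n} C(n,k) a(n-k) inv(k) = δ_{n,0}, i.e.
--   inv 0 = 1,  inv n = - Σ_{k<n} C(n,k) a(n-k) inv k.
-- invTable a n = [inv 0, …, inv n].
invTable : (ℕ → ℚ) → ℕ → List ℚ
invTable a zero = 1ℚ ∷ []
invTable a (suc n) =
  prev ∷ʳ (- (sumBelow (suc n) (λ k → ℕ→ℚ (suc n C k) * a (suc n ∸ k) * at prev k)))
  where prev = invTable a n

inv : (ℕ → ℚ) → ℕ → ℚ
inv a n = at (invTable a n) n

-- EGF coefficients of  Σ_{m≥0} (M)!/(M+2m)! t^{2m}  (M = 2N for E, M = 2N+1 for Ê):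
-- the t^n/n! coefficient is n! M!/(M+n)! for n even, 0 for n odd.
denomCoeff : ℕ → ℕ → ℚ
denomCoeff M n with ℕ._%_ n 2
... | zero  = _/_ (+ (n ! ℕ.* M !)) ((M ℕ.+ n) !) {{(M ℕ.+ n) !≢0}}
... | suc _ = 0ℚ

E : ℕ → ℕ → ℚ
E N = inv (denomCoeff (2 ℕ.* N))

Ê : ℕ → ℕ → ℚ
Ê N = inv (denomCoeff (suc (2 ℕ.* N)))

{-# OPTIONS --safe #-}
module Submission where

-- Read sequences as exponential generating functions: conv is their product, ∂ is d/dt and θ is t·d/dt.
-- With A and B the series of denomCoeff (2N) and denomCoeff (2N+1), one has A = B + θB/(2N+1),
-- E = 1/A and Ê = 1/B. Applying θ to B·Ê = 1 gives θB·Ê = −B·θÊ, so A·Ê = 1 − B·θÊ/(2N+1) and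
-- A·Ê² = Ê − θÊ/(2N+1). Multiplying by E gives Ê² = E·(Ê − θÊ/(2N+1)), whose n-th coefficient is the
-- right-hand side.

open import Defs
open import Data.Nat as ℕ using (ℕ; zero; suc; _∸_; _≥_; _!; z≤n; s≤s; NonZero)
import Data.Nat.Properties as ℕP
open import Data.Nat.Tactic.RingSolver using (solve-∀)
open import Data.Nat.Combinatorics using (_C_; nCk+nC[k+1]≡[n+1]C[k+1]; k>n⇒nCk≡0; nCn≡1)
open import Data.Integer as ℤ using (+_)
import Data.Integer.Properties as ℤP
open import Data.Rational using (ℚ; _+_; _*_; _-_; -_; _/_; 0ℚ; 1ℚ; fromℚᵘ)
import Data.Rational.Properties as ℚP
open ℚP using (toℚᵘ-injective; toℚᵘ-fromℚᵘ; fromℚᵘ-cong; toℚᵘ-homo-+; toℚᵘ-homo-*; toℚᵘ-homo‿-)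
open import Data.Rational.Solver using (module +-*-Solver)
open +-*-Solver using (solve; _:+_; _:*_; _:-_; :-_; _:=_; con)
import Data.Rational.Unnormalised as U
import Data.Rational.Unnormalised.Properties as UP
open import Data.List using (List; []; _∷_; _∷ʳ_; length)
open import Data.List.Properties using (length-++)
open import Data.Sum using (inj₁; inj₂)
open import Algebra.Bundles using (CommutativeMonoid)
open import Algebra.Properties.CommutativeSemigroup
  (CommutativeMonoid.commutativeSemigroup ℚP.+-0-commutativeMonoid) using (interchange; x∙yz≈y∙xz)
open import Algebra.Properties.Group ℚP.+-0-group using (inverseˡ-unique)
open import Relation.Binary.PropositionalEquality

fromℚᵘ-+ : ∀ p q → fromℚᵘ (p U.+ q) ≡ fromℚᵘ p + fromℚᵘ q
fromℚᵘ-+ p q = toℚᵘ-injective (UP.≃-trans (toℚᵘ-fromℚᵘ (p U.+ q)) (UP.≃-sym (UP.≃-trans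
  (toℚᵘ-homo-+ (fromℚᵘ p) (fromℚᵘ q)) (UP.+-cong (toℚᵘ-fromℚᵘ p) (toℚᵘ-fromℚᵘ q)))))

fromℚᵘ-* : ∀ p q → fromℚᵘ (p U.* q) ≡ fromℚᵘ p * fromℚᵘ q
fromℚᵘ-* p q = toℚᵘ-injective (UP.≃-trans (toℚᵘ-fromℚᵘ (p U.* q)) (UP.≃-sym (UP.≃-trans
  (toℚᵘ-homo-* (fromℚᵘ p) (fromℚᵘ q)) (UP.*-cong (toℚᵘ-fromℚᵘ p) (toℚᵘ-fromℚᵘ q)))))

fromℚᵘ-neg : ∀ p → fromℚᵘ (U.- p) ≡ - fromℚᵘ p
fromℚᵘ-neg p = toℚᵘ-injective (UP.≃-trans (toℚᵘ-fromℚᵘ (U.- p)) (UP.≃-sym (UP.≃-trans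
  (toℚᵘ-homo‿- (fromℚᵘ p)) (UP.-‿cong (toℚᵘ-fromℚᵘ p)))))

/1-+ : ∀ i j → (i ℤ.+ j) / 1 ≡ i / 1 + j / 1
/1-+ i j = trans
  (fromℚᵘ-cong {U.mkℚᵘ (i ℤ.+ j) 0} {U.mkℚᵘ i 0 U.+ U.mkℚᵘ j 0} (U.*≡* eq))
  (fromℚᵘ-+ (U.mkℚᵘ i 0) (U.mkℚᵘ j 0))
  where
  eq : (i ℤ.+ j) ℤ.* + 1 ≡ (i ℤ.* + 1 ℤ.+ j ℤ.* + 1) ℤ.* + 1
  eq = cong (ℤ._* + 1) (sym (cong₂ ℤ._+_ (ℤP.*-identityʳ i) (ℤP.*-identityʳ j)))

/1-neg : ∀ i → (ℤ.- i) / 1 ≡ - (i / 1)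
/1-neg i = fromℚᵘ-neg (U.mkℚᵘ i 0)

ℕ→ℚ-+ : ∀ a b → ℕ→ℚ (a ℕ.+ b) ≡ ℕ→ℚ a + ℕ→ℚ b
ℕ→ℚ-+ a b = trans (cong (_/ 1) (ℤP.pos-+ a b)) (/1-+ (+ a) (+ b))

/-split : ∀ i d → i / suc d ≡ i / 1 * (+ 1 / suc d)
/-split i d = trans
  (fromℚᵘ-cong {U.mkℚᵘ i d} {U.mkℚᵘ i 0 U.* U.mkℚᵘ (+ 1) d} (U.*≡* eq))
  (fromℚᵘ-* (U.mkℚᵘ i 0) (U.mkℚᵘ (+ 1) d))
  where
  eq : i ℤ.* + suc (d ℕ.+ 0) ≡ (i ℤ.* + 1) ℤ.* + suc d
  eq = cong₂ ℤ._*_ (sym (ℤP.*-identityʳ i)) (cong (λ e → + suc e) (ℕP.+-identityʳ d))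

/-cross : ∀ a b c d .{{_ : NonZero b}} .{{_ : NonZero d}} →
          a ℕ.* d ≡ c ℕ.* b → (+ a) / b ≡ (+ c) / d
/-cross a (suc b) c (suc d) ad≡cb = fromℚᵘ-cong {U.mkℚᵘ (+ a) b} {U.mkℚᵘ (+ c) d}
  (U.*≡* (trans (sym (ℤP.pos-* a (suc d))) (trans (cong +_ ad≡cb) (ℤP.pos-* c (suc b)))))

ℕ→ℚ-*-/ : ∀ a b d .{{_ : NonZero d}} → ℕ→ℚ a * ((+ b) / d) ≡ (+ (a ℕ.* b)) / d
ℕ→ℚ-*-/ a b (suc d) = trans
  (sym (fromℚᵘ-* (U.mkℚᵘ (+ a) 0) (U.mkℚᵘ (+ b) d)))
  (fromℚᵘ-cong {U.mkℚᵘ (+ a) 0 U.* U.mkℚᵘ (+ b) d} {U.mkℚᵘ (+ (a ℕ.* b)) d} (U.*≡* eq))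
  where
  eq : (+ a ℤ.* + b) ℤ.* + suc d ≡ + (a ℕ.* b) ℤ.* + suc (d ℕ.+ 0)
  eq = cong₂ ℤ._*_ (sym (ℤP.pos-* a b)) (cong (λ e → + suc e) (sym (ℕP.+-identityʳ d)))

/-inverseˡ : ∀ d → (+ 1 / suc d) * ℕ→ℚ (suc d) ≡ 1ℚ
/-inverseˡ d = begin
    (+ 1 / suc d) * ℕ→ℚ (suc d)  ≡⟨ ℚP.*-comm (+ 1 / suc d) (ℕ→ℚ (suc d)) ⟩
    ℕ→ℚ (suc d) * (+ 1 / suc d)  ≡⟨ ℕ→ℚ-*-/ (suc d) 1 (suc d) ⟩
    + (suc d ℕ.* 1) / suc d      ≡⟨ /-cross (suc d ℕ.* 1) (suc d) 1 1 eq ⟩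
    1ℚ                           ∎
  where
  open ≡-Reasoning
  eq : suc d ℕ.* 1 ℕ.* 1 ≡ 1 ℕ.* suc d
  eq = trans (ℕP.*-identityʳ _) (trans (ℕP.*-identityʳ _) (sym (ℕP.*-identityˡ _)))

Seq : Set
Seq = ℕ → ℚ

sumTo-cong : ∀ n {f g : Seq} → (∀ k → k ℕ.≤ n → f k ≡ g k) → sumTo n f ≡ sumTo n g
sumTo-cong zero    f≗g = f≗g 0 z≤n
sumTo-cong (suc n) f≗g =
  cong₂ _+_ (sumTo-cong n (λ k k≤n → f≗g k (ℕP.m≤n⇒m≤1+n k≤n))) (f≗g (suc n) ℕP.≤-refl)

sumTo-+ : ∀ n (f g : Seq) → sumTo n (λ k → f k + g k) ≡ sumTo n f + sumTo n g
sumTo-+ zero    f g = refl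
sumTo-+ (suc n) f g = trans (cong (_+ (f (suc n) + g (suc n))) (sumTo-+ n f g))
  (interchange (sumTo n f) (sumTo n g) (f (suc n)) (g (suc n)))

sumTo-* : ∀ n c (f : Seq) → sumTo n (λ k → c * f k) ≡ c * sumTo n f
sumTo-* zero    c f = refl
sumTo-* (suc n) c f = trans (cong (_+ c * f (suc n)) (sumTo-* n c f))
  (sym (ℚP.*-distribˡ-+ c (sumTo n f) (f (suc n))))

sumTo-suc : ∀ n (f : Seq) → sumTo (suc n) f ≡ f 0 + sumTo n (λ k → f (suc k))
sumTo-suc zero    f = refl
sumTo-suc (suc n) f = trans (cong (_+ f (suc (suc n))) (sumTo-suc n f)) (ℚP.+-assoc (f 0) _ _)

sumTo-0 : ∀ n (f : Seq) → (∀ k → f k ≡ 0ℚ) → sumTo n f ≡ 0ℚ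
sumTo-0 zero    f f≗0 = f≗0 0
sumTo-0 (suc n) f f≗0 = cong₂ _+_ (sumTo-0 n f f≗0) (f≗0 (suc n))

sumTo≡sumBelow : ∀ n (f : Seq) → sumTo n f ≡ sumBelow (suc n) f
sumTo≡sumBelow zero    f = sym (ℚP.+-identityˡ (f 0))
sumTo≡sumBelow (suc n) f = cong (_+ f (suc n)) (sumTo≡sumBelow n f)

conv : Seq → Seq → Seq
conv a b n = sumTo n (λ k → ℕ→ℚ (n C k) * a k * b (n ∸ k))

δ : Seq
δ zero    = 1ℚ
δ (suc _) = 0ℚ

∂ : Seq → Seq
∂ a k = a (suc k)

θ : Seq → Seq
θ a k = ℕ→ℚ k * a k

conv-congˡ : ∀ {a a'} b → (∀ k → a k ≡ a' k) → ∀ n → conv a b n ≡ conv a' b n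
conv-congˡ b a≗a' n = sumTo-cong n (λ k _ → cong (λ x → ℕ→ℚ (n C k) * x * b (n ∸ k)) (a≗a' k))

conv-congʳ : ∀ a {b b'} → (∀ k → b k ≡ b' k) → ∀ n → conv a b n ≡ conv a b' n
conv-congʳ a b≗b' n = sumTo-cong n (λ k _ → cong (ℕ→ℚ (n C k) * a k *_) (b≗b' (n ∸ k)))

conv-+ˡ : ∀ (a a' b : Seq) n → conv (λ k → a k + a' k) b n ≡ conv a b n + conv a' b n
conv-+ˡ a a' b n = trans
  (sumTo-cong n (λ k _ → distrib (ℕ→ℚ (n C k)) (a k) (a' k) (b (n ∸ k))))
  (sumTo-+ n _ _)
  where
  distrib : ∀ c x y z → c * (x + y) * z ≡ c * x * z + c * y * z
  distrib = solve 4 (λ c x y z → c :* (x :+ y) :* z := c :* x :* z :+ c :* y :* z) refl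

conv-*ˡ : ∀ s (a b : Seq) n → conv (λ k → s * a k) b n ≡ s * conv a b n
conv-*ˡ s a b n = trans (sumTo-cong n (λ k _ → pull (ℕ→ℚ (n C k)) (a k) (b (n ∸ k)))) (sumTo-* n s _)
  where
  pull : ∀ c x z → c * (s * x) * z ≡ s * (c * x * z)
  pull = solve 4 (λ s c x z → c :* (s :* x) :* z := s :* (c :* x :* z)) refl s

conv-∂ : ∀ (a b : Seq) n → ∂ (conv a b) n ≡ conv (∂ a) b n + conv a (∂ b) n
conv-∂ a b n = begin
    conv a b (suc n)
  ≡⟨ sumTo-suc n F ⟩
    F 0 + sumTo n (λ k → ℕ→ℚ (suc n C suc k) * a (suc k) * b (n ∸ k))
  ≡⟨ cong (_+_ (F 0)) (trans (sumTo-cong n (λ k _ → pascal k)) (sumTo-+ n _ _)) ⟩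
    F 0 + (conv (∂ a) b n + sumTo n T)
  ≡⟨ x∙yz≈y∙xz (F 0) (conv (∂ a) b n) (sumTo n T) ⟩
    conv (∂ a) b n + (F 0 + sumTo n T)
  ≡⟨ cong (_+_ (conv (∂ a) b n)) (sym (sumTo-suc n G)) ⟩
    conv (∂ a) b n + sumTo (suc n) G
  ≡⟨ cong (_+_ (conv (∂ a) b n)) top-vanishes ⟩
    conv (∂ a) b n + sumTo n G
  ≡⟨ cong (_+_ (conv (∂ a) b n))
       (sumTo-cong n (λ k k≤n → cong (λ i → ℕ→ℚ (n C k) * a k * b i) (ℕP.+-∸-assoc 1 k≤n))) ⟩
    conv (∂ a) b n + conv a (∂ b) n
  ∎
  where
  open ≡-Reasoning
  F G T : Seq
  F k = ℕ→ℚ (suc n C k) * a k * b (suc n ∸ k)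
  G k = ℕ→ℚ (n C k) * a k * b (suc n ∸ k)
  T k = ℕ→ℚ (n C suc k) * a (suc k) * b (n ∸ k)
  pascal : ∀ k → ℕ→ℚ (suc n C suc k) * a (suc k) * b (n ∸ k)
               ≡ ℕ→ℚ (n C k) * a (suc k) * b (n ∸ k) + T k
  pascal k = begin
      ℕ→ℚ (suc n C suc k) * a (suc k) * b (n ∸ k)
    ≡⟨ cong (λ c → ℕ→ℚ c * a (suc k) * b (n ∸ k)) (sym (nCk+nC[k+1]≡[n+1]C[k+1] n k)) ⟩
      ℕ→ℚ (n C k ℕ.+ n C suc k) * a (suc k) * b (n ∸ k)
    ≡⟨ cong (λ c → c * a (suc k) * b (n ∸ k)) (ℕ→ℚ-+ (n C k) (n C suc k)) ⟩
      (ℕ→ℚ (n C k) + ℕ→ℚ (n C suc k)) * a (suc k) * b (n ∸ k)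
    ≡⟨ solve 4 (λ c d x y → (c :+ d) :* x :* y := c :* x :* y :+ d :* x :* y) refl
         (ℕ→ℚ (n C k)) (ℕ→ℚ (n C suc k)) (a (suc k)) (b (n ∸ k)) ⟩
      ℕ→ℚ (n C k) * a (suc k) * b (n ∸ k) + T k
    ∎
  top-vanishes : sumTo (suc n) G ≡ sumTo n G
  top-vanishes = begin
      sumTo n G + ℕ→ℚ (n C suc n) * a (suc n) * b (n ∸ n)
    ≡⟨ cong (λ c → sumTo n G + ℕ→ℚ c * a (suc n) * b (n ∸ n)) (k>n⇒nCk≡0 (ℕP.n<1+n n)) ⟩
      sumTo n G + 0ℚ * a (suc n) * b (n ∸ n)
    ≡⟨ solve 3 (λ s x y → s :+ con 0ℚ :* x :* y := s) refl (sumTo n G) (a (suc n)) (b (n ∸ n)) ⟩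
      sumTo n G
    ∎

conv-comm : ∀ (a b : Seq) n → conv a b n ≡ conv b a n
conv-comm a b zero    = solve 3 (λ c x y → c :* x :* y := c :* y :* x) refl (ℕ→ℚ 1) (a 0) (b 0)
conv-comm a b (suc n) = begin
    conv a b (suc n)
  ≡⟨ conv-∂ a b n ⟩
    conv (∂ a) b n + conv a (∂ b) n
  ≡⟨ cong₂ _+_ (conv-comm (∂ a) b n) (conv-comm a (∂ b) n) ⟩
    conv b (∂ a) n + conv (∂ b) a n
  ≡⟨ ℚP.+-comm (conv b (∂ a) n) (conv (∂ b) a n) ⟩
    conv (∂ b) a n + conv b (∂ a) n
  ≡⟨ sym (conv-∂ b a n) ⟩
    conv b a (suc n)
  ∎
  where open ≡-Reasoning

conv-+ʳ : ∀ (a b b' : Seq) n → conv a (λ k → b k + b' k) n ≡ conv a b n + conv a b' n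
conv-+ʳ a b b' n = trans (conv-comm a _ n)
  (trans (conv-+ˡ b b' a n) (cong₂ _+_ (conv-comm b a n) (conv-comm b' a n)))

conv-assoc : ∀ (a b c : Seq) n → conv (conv a b) c n ≡ conv a (conv b c) n
conv-assoc a b c zero =
  solve 4 (λ o x y z → o :* (o :* x :* y) :* z := o :* x :* (o :* y :* z)) refl (ℕ→ℚ 1) (a 0) (b 0) (c 0)
conv-assoc a b c (suc n) = begin
    conv (conv a b) c (suc n)
  ≡⟨ conv-∂ (conv a b) c n ⟩
    conv (∂ (conv a b)) c n + conv (conv a b) (∂ c) n
  ≡⟨ cong (_+ conv (conv a b) (∂ c) n)
       (trans (conv-congˡ c (conv-∂ a b) n) (conv-+ˡ (conv (∂ a) b) (conv a (∂ b)) c n)) ⟩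
    (conv (conv (∂ a) b) c n + conv (conv a (∂ b)) c n) + conv (conv a b) (∂ c) n
  ≡⟨ cong₂ _+_ (cong₂ _+_ (conv-assoc (∂ a) b c n) (conv-assoc a (∂ b) c n)) (conv-assoc a b (∂ c) n) ⟩
    (conv (∂ a) (conv b c) n + conv a (conv (∂ b) c) n) + conv a (conv b (∂ c)) n
  ≡⟨ ℚP.+-assoc (conv (∂ a) (conv b c) n) _ _ ⟩
    conv (∂ a) (conv b c) n + (conv a (conv (∂ b) c) n + conv a (conv b (∂ c)) n)
  ≡⟨ cong (_+_ (conv (∂ a) (conv b c) n))
       (sym (trans (conv-congʳ a (conv-∂ b c) n) (conv-+ʳ a (conv (∂ b) c) (conv b (∂ c)) n))) ⟩
    conv (∂ a) (conv b c) n + conv a (∂ (conv b c)) n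
  ≡⟨ sym (conv-∂ a (conv b c) n) ⟩
    conv a (conv b c) (suc n)
  ∎
  where open ≡-Reasoning

conv-identityˡ : ∀ (a : Seq) n → conv δ a n ≡ a n
conv-identityˡ a zero    = ℚP.*-identityˡ (a 0)
conv-identityˡ a (suc n) = begin
    conv δ a (suc n)
  ≡⟨ sumTo-suc n _ ⟩
    ℕ→ℚ 1 * 1ℚ * a (suc n) + sumTo n (λ k → ℕ→ℚ (suc n C suc k) * 0ℚ * a (n ∸ k))
  ≡⟨ cong (_+_ (ℕ→ℚ 1 * 1ℚ * a (suc n)))
       (sumTo-0 n _ (λ k → annihilate (ℕ→ℚ (suc n C suc k)) (a (n ∸ k)))) ⟩
    ℕ→ℚ 1 * 1ℚ * a (suc n) + 0ℚ
  ≡⟨ solve 1 (λ x → con 1ℚ :* con 1ℚ :* x :+ con 0ℚ := x) refl (a (suc n)) ⟩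
    a (suc n)
  ∎
  where
  open ≡-Reasoning
  annihilate : ∀ c x → c * 0ℚ * x ≡ 0ℚ
  annihilate = solve 2 (λ c x → c :* con 0ℚ :* x := con 0ℚ) refl

conv-identityʳ : ∀ (a : Seq) n → conv a δ n ≡ a n
conv-identityʳ a n = trans (conv-comm a δ n) (conv-identityˡ a n)

conv-θ : ∀ (a b : Seq) n → conv (θ a) b n + conv a (θ b) n ≡ ℕ→ℚ n * conv a b n
conv-θ a b n = trans (sym (sumTo-+ n _ _)) (trans (sumTo-cong n term) (sumTo-* n (ℕ→ℚ n) _))
  where
  term : ∀ k → k ℕ.≤ n → ℕ→ℚ (n C k) * θ a k * b (n ∸ k) + ℕ→ℚ (n C k) * a k * θ b (n ∸ k)
                       ≡ ℕ→ℚ n * (ℕ→ℚ (n C k) * a k * b (n ∸ k))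
  term k k≤n = begin
      ℕ→ℚ (n C k) * θ a k * b (n ∸ k) + ℕ→ℚ (n C k) * a k * θ b (n ∸ k)
    ≡⟨ solve 5 (λ c x y i j → c :* (i :* x) :* y :+ c :* x :* (j :* y) := (i :+ j) :* (c :* x :* y)) refl
         (ℕ→ℚ (n C k)) (a k) (b (n ∸ k)) (ℕ→ℚ k) (ℕ→ℚ (n ∸ k)) ⟩
      (ℕ→ℚ k + ℕ→ℚ (n ∸ k)) * (ℕ→ℚ (n C k) * a k * b (n ∸ k))
    ≡⟨ cong (_* (ℕ→ℚ (n C k) * a k * b (n ∸ k)))
         (trans (sym (ℕ→ℚ-+ k (n ∸ k))) (cong ℕ→ℚ (ℕP.m+[n∸m]≡n k≤n))) ⟩
      ℕ→ℚ n * (ℕ→ℚ (n C k) * a k * b (n ∸ k))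
    ∎
    where open ≡-Reasoning

at-∷ʳ-< : ∀ (xs : List ℚ) x k → k ℕ.< length xs → at (xs ∷ʳ x) k ≡ at xs k
at-∷ʳ-< (y ∷ ys) x zero    _         = refl
at-∷ʳ-< (y ∷ ys) x (suc k) (s≤s k<n) = at-∷ʳ-< ys x k k<n

at-∷ʳ-length : ∀ (xs : List ℚ) x → at (xs ∷ʳ x) (length xs) ≡ x
at-∷ʳ-length []       x = refl
at-∷ʳ-length (y ∷ ys) x = at-∷ʳ-length ys x

length-invTable : ∀ a n → length (invTable a n) ≡ suc n
length-invTable a zero    = refl
length-invTable a (suc n) =
  trans (length-++ (invTable a n)) (trans (cong (ℕ._+ 1) (length-invTable a n)) (ℕP.+-comm (suc n) 1))

at-invTable : ∀ a n k → k ℕ.≤ n → at (invTable a n) k ≡ inv a k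
at-invTable a zero    zero _   = refl
at-invTable a (suc n) k k≤1+n with ℕP.m≤n⇒m<n∨m≡n k≤1+n
... | inj₂ refl      = refl
... | inj₁ (s≤s k≤n) = trans
  (at-∷ʳ-< (invTable a n) _ k (subst (k ℕ.<_) (sym (length-invTable a n)) (s≤s k≤n)))
  (at-invTable a n k k≤n)

inv-suc : ∀ a n → inv a (suc n) ≡ - sumTo n (λ k → ℕ→ℚ (suc n C k) * a (suc n ∸ k) * inv a k)
inv-suc a n = begin
    at (invTable a n ∷ʳ - sumBelow (suc n) term) (suc n)
  ≡⟨ cong (at (invTable a n ∷ʳ _)) (sym (length-invTable a n)) ⟩
    at (invTable a n ∷ʳ - sumBelow (suc n) term) (length (invTable a n))
  ≡⟨ at-∷ʳ-length (invTable a n) _ ⟩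
    - sumBelow (suc n) term
  ≡⟨ cong -_ (sym (sumTo≡sumBelow n term)) ⟩
    - sumTo n term
  ≡⟨ cong -_ (sumTo-cong n (λ k k≤n → cong (ℕ→ℚ (suc n C k) * a (suc n ∸ k) *_) (at-invTable a n k k≤n))) ⟩
    - sumTo n (λ k → ℕ→ℚ (suc n C k) * a (suc n ∸ k) * inv a k)
  ∎
  where
  open ≡-Reasoning
  term : Seq
  term k = ℕ→ℚ (suc n C k) * a (suc n ∸ k) * at (invTable a n) k

conv-inv : ∀ a → a 0 ≡ 1ℚ → ∀ n → conv (inv a) a n ≡ δ n
conv-inv a a₀≡1 zero    = cong (ℕ→ℚ 1 * 1ℚ *_) a₀≡1
conv-inv a a₀≡1 (suc n) = begin
    sumTo n T + ℕ→ℚ (suc n C suc n) * inv a (suc n) * a (n ∸ n)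
  ≡⟨ cong₂ (λ c i → sumTo n T + ℕ→ℚ c * inv a (suc n) * a i) (nCn≡1 (suc n)) (ℕP.n∸n≡0 n) ⟩
    sumTo n T + ℕ→ℚ 1 * inv a (suc n) * a 0
  ≡⟨ cong₂ (λ x y → sumTo n T + ℕ→ℚ 1 * x * y) (inv-suc a n) a₀≡1 ⟩
    sumTo n T + ℕ→ℚ 1 * (- sumTo n T') * 1ℚ
  ≡⟨ cong (λ s → sumTo n T + ℕ→ℚ 1 * (- s) * 1ℚ)
       (sumTo-cong n (λ k _ → swap (ℕ→ℚ (suc n C k)) (a (suc n ∸ k)) (inv a k))) ⟩
    sumTo n T + ℕ→ℚ 1 * (- sumTo n T) * 1ℚ
  ≡⟨ solve 1 (λ s → s :+ con 1ℚ :* (:- s) :* con 1ℚ := con 0ℚ) refl (sumTo n T) ⟩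
    0ℚ
  ∎
  where
  open ≡-Reasoning
  T T' : Seq
  T  k = ℕ→ℚ (suc n C k) * inv a k * a (suc n ∸ k)
  T' k = ℕ→ℚ (suc n C k) * a (suc n ∸ k) * inv a k
  swap : ∀ c x y → c * x * y ≡ c * y * x
  swap = solve 3 (λ c x y → c :* x :* y := c :* y :* x) refl

θ-δ : ∀ n → θ δ n ≡ 0ℚ
θ-δ zero    = refl
θ-δ (suc n) = ℚP.*-zeroʳ (ℕ→ℚ (suc n))

conv-θ-inverse : ∀ (b h : Seq) → (∀ n → conv b h n ≡ δ n) → ∀ n → conv (θ b) h n ≡ - conv b (θ h) n
conv-θ-inverse b h b*h≡δ n = inverseˡ-unique (conv (θ b) h n) (conv b (θ h) n)
  (trans (conv-θ b h n) (trans (cong (ℕ→ℚ n *_) (b*h≡δ n)) (θ-δ n)))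

reciprocal-square : ∀ (a b g h : Seq) μ → (∀ n → a n ≡ b n + μ * θ b n) →
  (∀ n → conv g a n ≡ δ n) → (∀ n → conv h b n ≡ δ n) →
  ∀ n → conv h h n ≡ conv g (λ k → h k - μ * θ h k) n
reciprocal-square a b g h μ a≡b+μθb g*a≡δ h*b≡δ n = begin
    conv h h n
  ≡⟨ sym (conv-identityˡ (conv h h) n) ⟩
    conv δ (conv h h) n
  ≡⟨ conv-congˡ (conv h h) (λ k → sym (g*a≡δ k)) n ⟩
    conv (conv g a) (conv h h) n
  ≡⟨ conv-assoc g a (conv h h) n ⟩
    conv g (conv a (conv h h)) n
  ≡⟨ conv-congʳ g (λ k → trans (sym (conv-assoc a h h k)) (a*h*h k)) n ⟩
    conv g (λ k → h k - μ * θ h k) n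
  ∎
  where
  open ≡-Reasoning
  b*h≡δ : ∀ k → conv b h k ≡ δ k
  b*h≡δ k = trans (conv-comm b h k) (h*b≡δ k)
  a*h : ∀ k → conv a h k ≡ δ k + (- μ) * conv b (θ h) k
  a*h k = begin
      conv a h k
    ≡⟨ conv-congˡ h a≡b+μθb k ⟩
      conv (λ j → b j + μ * θ b j) h k
    ≡⟨ conv-+ˡ b (λ j → μ * θ b j) h k ⟩
      conv b h k + conv (λ j → μ * θ b j) h k
    ≡⟨ cong₂ _+_ (b*h≡δ k) (conv-*ˡ μ (θ b) h k) ⟩
      δ k + μ * conv (θ b) h k
    ≡⟨ cong (λ x → δ k + μ * x) (conv-θ-inverse b h b*h≡δ k) ⟩
      δ k + μ * - conv b (θ h) k
    ≡⟨ cong (_+_ (δ k)) (trans (sym (ℚP.neg-distribʳ-* μ _)) (ℚP.neg-distribˡ-* μ _)) ⟩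
      δ k + (- μ) * conv b (θ h) k
    ∎
  b*θh*h : ∀ k → conv (conv b (θ h)) h k ≡ θ h k
  b*θh*h k = begin
      conv (conv b (θ h)) h k
    ≡⟨ conv-congˡ h (λ j → conv-comm b (θ h) j) k ⟩
      conv (conv (θ h) b) h k
    ≡⟨ conv-assoc (θ h) b h k ⟩
      conv (θ h) (conv b h) k
    ≡⟨ conv-congʳ (θ h) b*h≡δ k ⟩
      conv (θ h) δ k
    ≡⟨ conv-identityʳ (θ h) k ⟩
      θ h k
    ∎
  a*h*h : ∀ k → conv (conv a h) h k ≡ h k - μ * θ h k
  a*h*h k = begin
      conv (conv a h) h k
    ≡⟨ conv-congˡ h a*h k ⟩
      conv (λ j → δ j + (- μ) * conv b (θ h) j) h k
    ≡⟨ conv-+ˡ δ (λ j → (- μ) * conv b (θ h) j) h k ⟩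
      conv δ h k + conv (λ j → (- μ) * conv b (θ h) j) h k
    ≡⟨ cong₂ _+_ (conv-identityˡ h k) (conv-*ˡ (- μ) (conv b (θ h)) h k) ⟩
      h k + (- μ) * conv (conv b (θ h)) h k
    ≡⟨ cong (λ x → h k + (- μ) * x) (b*θh*h k) ⟩
      h k + (- μ) * θ h k
    ≡⟨ cong (_+_ (h k)) (sym (ℚP.neg-distribˡ-* μ (θ h k))) ⟩
      h k - μ * θ h k
    ∎

denomCoeff-zero : ∀ M → denomCoeff M 0 ≡ 1ℚ
denomCoeff-zero M = /-cross (1 ℕ.* M !) ((M ℕ.+ 0) !) 1 1 {{(M ℕ.+ 0) ℕP.!≢0}} (begin
    1 ℕ.* M ! ℕ.* 1  ≡⟨ ℕP.*-identityʳ (1 ℕ.* M !) ⟩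
    1 ℕ.* M !        ≡⟨ cong (λ m → 1 ℕ.* m !) (ℕP.+-identityʳ M) ⟨
    1 ℕ.* (M ℕ.+ 0) ! ∎)
  where open ≡-Reasoning

denomCoeff-step : ∀ M n → ℕ→ℚ (suc M) * denomCoeff M n ≡ ℕ→ℚ (suc M ℕ.+ n) * denomCoeff (suc M) n
denomCoeff-step M n with n ℕ.% 2
... | suc _ = trans (ℚP.*-zeroʳ (ℕ→ℚ (suc M))) (sym (ℚP.*-zeroʳ (ℕ→ℚ (suc M ℕ.+ n))))
... | zero  = begin
    ℕ→ℚ (suc M) * ((+ (n ! ℕ.* M !)) / ((M ℕ.+ n) !))
  ≡⟨ ℕ→ℚ-*-/ (suc M) (n ! ℕ.* M !) ((M ℕ.+ n) !) ⟩
    ((+ (suc M ℕ.* (n ! ℕ.* M !))) / ((M ℕ.+ n) !))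
  ≡⟨ /-cross (suc M ℕ.* (n ! ℕ.* M !)) ((M ℕ.+ n) !) ((suc M ℕ.+ n) ℕ.* (n ! ℕ.* suc M !)) ((suc M ℕ.+ n) !)
       (factorials M n (n !) (M !) ((M ℕ.+ n) !)) ⟩
    ((+ ((suc M ℕ.+ n) ℕ.* (n ! ℕ.* suc M !))) / ((suc M ℕ.+ n) !))
  ≡⟨ ℕ→ℚ-*-/ (suc M ℕ.+ n) (n ! ℕ.* suc M !) ((suc M ℕ.+ n) !) ⟨
    ℕ→ℚ (suc M ℕ.+ n) * ((+ (n ! ℕ.* suc M !)) / ((suc M ℕ.+ n) !))
  ∎
  where
  open ≡-Reasoning
  instance
    [M+n]!≢0 : NonZero ((M ℕ.+ n) !)
    [M+n]!≢0 = (M ℕ.+ n) ℕP.!≢0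
    [1+M+n]!≢0 : NonZero ((suc M ℕ.+ n) !)
    [1+M+n]!≢0 = (suc M ℕ.+ n) ℕP.!≢0
  factorials : ∀ M n f g h → suc M ℕ.* (f ℕ.* g) ℕ.* (suc (M ℕ.+ n) ℕ.* h)
                           ≡ suc (M ℕ.+ n) ℕ.* (f ℕ.* (suc M ℕ.* g)) ℕ.* h
  factorials = solve-∀

denomCoeff-shift : ∀ M n → denomCoeff M n ≡ denomCoeff (suc M) n + (+ 1 / suc M) * θ (denomCoeff (suc M)) n
denomCoeff-shift M n = begin
    A
  ≡⟨ sym (ℚP.*-identityˡ A) ⟩
    1ℚ * A
  ≡⟨ cong (_* A) (sym (/-inverseˡ M)) ⟩
    μ * c * A
  ≡⟨ ℚP.*-assoc μ c A ⟩
    μ * (c * A)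
  ≡⟨ cong (μ *_) (denomCoeff-step M n) ⟩
    μ * (ℕ→ℚ (suc M ℕ.+ n) * B)
  ≡⟨ cong (λ x → μ * (x * B)) (ℕ→ℚ-+ (suc M) n) ⟩
    μ * ((c + ℕ→ℚ n) * B)
  ≡⟨ solve 4 (λ μ c k B → μ :* ((c :+ k) :* B) := μ :* c :* B :+ μ :* (k :* B)) refl μ c (ℕ→ℚ n) B ⟩
    μ * c * B + μ * θ (denomCoeff (suc M)) n
  ≡⟨ cong (λ x → x * B + μ * θ (denomCoeff (suc M)) n) (/-inverseˡ M) ⟩
    1ℚ * B + μ * θ (denomCoeff (suc M)) n
  ≡⟨ cong (_+ μ * θ (denomCoeff (suc M)) n) (ℚP.*-identityˡ B) ⟩
    B + μ * θ (denomCoeff (suc M)) n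
  ∎
  where
  open ≡-Reasoning
  A B c μ : ℚ
  A = denomCoeff M n
  B = denomCoeff (suc M) n
  c = ℕ→ℚ (suc M)
  μ = + 1 / suc M

fraction-complement : ∀ m k → (+ (m ℕ.+ 1) ℤ.- + k) / suc m ≡ 1ℚ - (+ 1 / suc m) * ℕ→ℚ k
fraction-complement m k = begin
    (+ (m ℕ.+ 1) ℤ.- + k) / suc m
  ≡⟨ cong (λ m+1 → (+ m+1 ℤ.- + k) / suc m) (ℕP.+-comm m 1) ⟩
    (+ suc m ℤ.- + k) / suc m
  ≡⟨ /-split (+ suc m ℤ.- + k) m ⟩
    (+ suc m ℤ.- + k) / 1 * μ
  ≡⟨ cong (_* μ) (trans (/1-+ (+ suc m) (ℤ.- + k)) (cong (_+_ (ℕ→ℚ (suc m))) (/1-neg (+ k)))) ⟩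
    (ℕ→ℚ (suc m) - ℕ→ℚ k) * μ
  ≡⟨ solve 3 (λ c k μ → (c :- k) :* μ := μ :* c :- μ :* k) refl (ℕ→ℚ (suc m)) (ℕ→ℚ k) μ ⟩
    μ * ℕ→ℚ (suc m) - μ * ℕ→ℚ k
  ≡⟨ cong (_- μ * ℕ→ℚ k) (/-inverseˡ m) ⟩
    1ℚ - μ * ℕ→ℚ k
  ∎
  where
  open ≡-Reasoning
  μ : ℚ
  μ = + 1 / suc m

θ-complement : ∀ m (h : Seq) k → h k - (+ 1 / suc m) * θ h k ≡ (+ (m ℕ.+ 1) ℤ.- + k) / suc m * h k
θ-complement m h k = begin
    h k - μ * (ℕ→ℚ k * h k)
  ≡⟨ solve 3 (λ h μ k → h :- μ :* (k :* h) := (con 1ℚ :- μ :* k) :* h) refl (h k) μ (ℕ→ℚ k) ⟩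
    (1ℚ - μ * ℕ→ℚ k) * h k
  ≡⟨ cong (_* h k) (sym (fraction-complement m k)) ⟩
    (+ (m ℕ.+ 1) ℤ.- + k) / suc m * h k
  ∎
  where
  open ≡-Reasoning
  μ : ℚ
  μ = + 1 / suc m

theorem6 : ∀ (N n : ℕ) → N ≥ 1 →
    sumTo n (λ i → ℕ→ℚ (n C i) * Ê N i * Ê N (n ∸ i))
      ≡ sumTo n (λ k → ℕ→ℚ (n C k)
          * ((+ (2 ℕ.* N ℕ.+ 1) ℤ.- + k) / (suc (2 ℕ.* N)))
          * Ê N k * E N (n ∸ k))
-- The identity holds for N = 0 as well.
theorem6 N n _ = begin
    conv (Ê N) (Ê N) n
  ≡⟨ reciprocal-square A B (E N) (Ê N) μ (denomCoeff-shift K)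
       (conv-inv A (denomCoeff-zero K)) (conv-inv B (denomCoeff-zero (suc K))) n ⟩
    conv (E N) (λ k → Ê N k - μ * θ (Ê N) k) n
  ≡⟨ conv-comm (E N) _ n ⟩
    conv (λ k → Ê N k - μ * θ (Ê N) k) (E N) n
  ≡⟨ sumTo-cong n (λ k _ → cong (λ x → ℕ→ℚ (n C k) * x * E N (n ∸ k)) (θ-complement K (Ê N) k)) ⟩
    sumTo n (λ k → ℕ→ℚ (n C k) * (coefficient k * Ê N k) * E N (n ∸ k))
  ≡⟨ sumTo-cong n (λ k _ → cong (_* E N (n ∸ k)) (sym (ℚP.*-assoc (ℕ→ℚ (n C k)) (coefficient k) (Ê N k)))) ⟩
    sumTo n (λ k → ℕ→ℚ (n C k) * coefficient k * Ê N k * E N (n ∸ k))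
  ∎
  where
  open ≡-Reasoning
  K : ℕ
  K = 2 ℕ.* N
  A B : Seq
  A = denomCoeff K
  B = denomCoeff (suc K)
  μ : ℚ
  μ = + 1 / suc K
  coefficient : ℕ → ℚ
  coefficient k = (+ (K ℕ.+ 1) ℤ.- + k) / suc K
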